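{- Let $f(x)=\sum_{n\ge0}f_nx^n$ where $(f_n)_{n\ge0}$ is a Pólya frequency sequence with $f_n>0$ for all $n\ge 0$. Then the Riordan array $\mathcal{R}(f(x),f(x))$ is strictly totally positive and the Riordan array $\mathcal{R}(f(x),xf(x))$ is lower strictly totally positive.
   Context: For formal power series $g(x),h(x)$, the Riordan array $\mathcal{R}(g(x),h(x))$ is the infinite matrix (rows, columns indexed from $0$) whose $(n,k)$ entry is $[x^n]\,g(x)h(x)^k$. A sequence $(a_k)_{k\ge0}$ of nonnegative numbers is a Pólya frequency (PF) sequence if its Toeplitz matrix $[a_{i-j}]_{i,j\ge0}$ (with $a_m=0$ for $m<0$) is totally positive. A matrix is totally positive (TP) if all its minors are nonnegative and strictly totally positive (STP) if all its minors are positive. A lower triangular matrix $A$ is lower strictly totally positive (LSTP) if it is TP and its minor with rows $i_0<\cdots<i_k$ and columns $j_0<\cdots<j_k$ is positive whenever $i_\ell\ge j_\ell$ for every $\ell$. -}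

module Defs where

open import Data.Nat as ℕ using (ℕ; zero; suc; _∸_)
open import Data.Nat.Properties using (_≤?_)
open import Data.Fin as Fin using (Fin; zero; suc; toℕ; punchIn)
open import Data.Product using (Σ; ∃; _×_; _,_)
open import Data.Sum using (_⊎_)
open import Relation.Nullary using (¬_; yes; no)
open import Relation.Binary.PropositionalEquality using (_≡_)
open import Relation.Binary.Structures using (IsStrictTotalOrder)
open import Algebra.Structures using (IsCommutativeRing)

-- The real numbers, axiomatised as a (Dedekind-)complete ordered field.
-- (agda-stdlib has no reals; any model of this record is ℝ.)

record CompleteOrderedField : Set₁ where
  infixl 6 _+_
  infixl 7 _*_
  infix 4 _<_ _≤_
  field
    Carrier : Set
    _+_ _*_ : Carrier → Carrier → Carrier
    -_      : Carrier → Carrier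
    0# 1#   : Carrier
    _<_     : Carrier → Carrier → Set
    isCommutativeRing   : IsCommutativeRing _≡_ _+_ _*_ -_ 0# 1#
    <-isStrictTotalOrder : IsStrictTotalOrder _≡_ _<_
    +-mono-<  : ∀ {a b} c → a < b → a + c < b + c
    *-pos     : ∀ {a b} → 0# < a → 0# < b → 0# < a * b
    0≢1       : ¬ (0# ≡ 1#)
    inverse   : ∀ a → ¬ (a ≡ 0#) → Σ Carrier (λ b → a * b ≡ 1#)

  _≤_ : Carrier → Carrier → Set
  a ≤ b = (a < b) ⊎ (a ≡ b)

  IsUpperBound : (Carrier → Set) → Carrier → Set
  IsUpperBound S u = ∀ x → S x → x ≤ u

  field
    sup : (S : Carrier → Set) → Σ Carrier S → Σ Carrier (IsUpperBound S) →
          Σ Carrier (λ s → IsUpperBound S s × (∀ u → IsUpperBound S u → s ≤ u))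

module Theory (R : CompleteOrderedField) where
  open CompleteOrderedField R

  -- sequences = coefficient sequences of formal power series
  Seq : Set
  Seq = ℕ → Carrier

  -- infinite matrices indexed from 0
  Matrix : Set
  Matrix = ℕ → ℕ → Carrier

  sumTo : ℕ → (ℕ → Carrier) → Carrier
  sumTo zero    a = 0#
  sumTo (suc n) a = sumTo n a + a n

  conv : Seq → Seq → Seq
  conv a b n = sumTo (suc n) (λ i → a i * b (n ∸ i))

  one : Seq
  one zero    = 1#
  one (suc n) = 0#

  pow : Seq → ℕ → Seq
  pow h zero    = one
  pow h (suc k) = conv h (pow h k)

  xMul : Seq → Seq
  xMul h zero    = 0#
  xMul h (suc n) = h n

  riordan : Seq → Seq → Matrix
  riordan g h n k = conv g (pow h k) n

  sumFin : ∀ {k} → (Fin k → Carrier) → Carrier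
  sumFin {zero}  a = 0#
  sumFin {suc k} a = a zero + sumFin (λ i → a (suc i))

  sign : ℕ → Carrier → Carrier
  sign zero          x = x
  sign (suc zero)    x = - x
  sign (suc (suc n)) x = sign n x

  det : (k : ℕ) → (Fin k → Fin k → Carrier) → Carrier
  det zero    M = 1#
  det (suc k) M =
    sumFin (λ j → sign (toℕ j) (M zero j * det k (λ r c → M (suc r) (punchIn j c))))

  Increasing : ∀ {k} → (Fin k → ℕ) → Set
  Increasing {k} ι = ∀ (i j : Fin k) → i Fin.< j → ι i ℕ.< ι j

  minor : Matrix → (k : ℕ) → (Fin k → ℕ) → (Fin k → ℕ) → Carrier
  minor M k ι κ = det k (λ r c → M (ι r) (κ c))

  TP : Matrix → Set
  TP M = ∀ (k : ℕ) (ι κ : Fin k → ℕ) → Increasing ι → Increasing κ →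
         0# ≤ minor M k ι κ

  STP : Matrix → Set
  STP M = ∀ (k : ℕ) (ι κ : Fin k → ℕ) → Increasing ι → Increasing κ →
          0# < minor M k ι κ

  LowerTriangular : Matrix → Set
  LowerTriangular M = ∀ n k → n ℕ.< k → M n k ≡ 0#

  LSTP : Matrix → Set
  LSTP M = LowerTriangular M × TP M ×
           (∀ (k : ℕ) (ι κ : Fin k → ℕ) → Increasing ι → Increasing κ →
              (∀ l → κ l ℕ.≤ ι l) → 0# < minor M k ι κ)

  toeplitz : Seq → Matrix
  toeplitz a i j with j ≤? i
  ... | yes _ = a (i ∸ j)
  ... | no  _ = 0#

  IsPF : Seq → Set
  IsPF a = (∀ n → 0# ≤ a n) × TP (toeplitz a)

-- Let T be the Toeplitz matrix of f, totally positive since f is a PF sequence.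
-- Column k of R(f, h) is f · h^k, so R(f, h) = T · C where C has the columns h^k,
-- and by Cauchy–Binet every minor of R(f, h) is a sum of products of a minor of T
-- and a minor of C. The first column of C is (1, 0, 0, …); its other columns are
-- the columns of R(f, f) itself when h = f, and those of R(f, x f) moved down one
-- row when h = x f. Induction on the largest column (resp. row) index therefore
-- makes all these products nonnegative. Positivity comes from a single term: if
-- the summation indices J interlace the rows ι (J l ≤ ι l < J (l + 1)), the minor
-- of T is triangular with diagonal entries f_i > 0, and the matching minor of C
-- is positive by induction.

module Submission where

open import Defs
open import Algebra.Bundles using (CommutativeRing; RawRing)
open import Algebra.Solver.Ring.AlmostCommutativeRing
  using (fromCommutativeRing; _-Raw-AlmostCommutative⟶_)
import Algebra.Properties.Ring as RingProperties
import Algebra.Properties.Semiring.Mult as SemiringMult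
open import Data.Empty using (⊥-elim)
open import Data.Fin as Fin using (Fin; zero; suc; toℕ; punchIn)
import Data.Fin.Properties as Finₚ
open import Data.Maybe using (Maybe; just; nothing)
open import Data.Nat as ℕ using (ℕ; zero; suc; z≤n; s≤s; _∸_; pred)
import Data.Nat.Properties as ℕₚ
open import Data.Product using (Σ; _×_; _,_; proj₁; proj₂)
open import Data.Sum using (_⊎_; inj₁; inj₂)
open import Data.Unit using (⊤; tt)
open import Data.Vec.Functional using ([]; _∷_)
open import Level using (0ℓ)
open import Relation.Binary.Definitions using (tri<; tri≈; tri>)
open import Relation.Binary.PropositionalEquality
open import Relation.Binary.Structures using (IsStrictTotalOrder)
open import Relation.Nullary using (yes; no)

module Positivity (R : CompleteOrderedField) where
  open CompleteOrderedField R
  open Theory R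
  open ≡-Reasoning

  commutativeRing : CommutativeRing 0ℓ 0ℓ
  commutativeRing = record { isCommutativeRing = isCommutativeRing }

  open CommutativeRing commutativeRing
    using (+-assoc; +-comm; +-identityˡ; +-identityʳ; *-comm; *-identityˡ;
           -‿inverseʳ; distribˡ; distribʳ; zeroˡ; zeroʳ)
  open RingProperties (CommutativeRing.ring commutativeRing)
    using (-‿distribˡ-*; -‿distribʳ-*; -‿involutive; -0#≈0#; -‿anti-homo-+)
  open SemiringMult (CommutativeRing.semiring commutativeRing) using (×-homo-+; ×1-homo-*) renaming (_×_ to _∙_)

  -- Integer coefficients are reduced differences (a , b) ↦ a - b, so that the
  -- normal forms of two equal ring expressions are syntactically equal.
  Diff : Set
  Diff = ℕ × ℕ

  reduce : ℕ → ℕ → Diff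
  reduce a b = a ∸ b , b ∸ a

  _⊕_ _⊛_ : Diff → Diff → Diff
  (a , b) ⊕ (c , d) = reduce (a ℕ.+ c) (b ℕ.+ d)
  (a , b) ⊛ (c , d) = reduce (a ℕ.* c ℕ.+ b ℕ.* d) (a ℕ.* d ℕ.+ b ℕ.* c)

  ⊝ : Diff → Diff
  ⊝ (a , b) = b , a

  diffRing : RawRing 0ℓ 0ℓ
  diffRing = record
    { Carrier = Diff ; _≈_ = _≡_ ; _+_ = _⊕_ ; _*_ = _⊛_ ; -_ = ⊝ ; 0# = 0 , 0 ; 1# = 1 , 0 }

  ⟦_⟧ : Diff → Carrier
  ⟦ a , b ⟧ = a ∙ 1# + - (b ∙ 1#)

  -‿+-distrib : ∀ x y → - (x + y) ≡ - x + - y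
  -‿+-distrib x y = trans (-‿anti-homo-+ x y) (+-comm _ _)

  +-interchange : ∀ a b c d → (a + b) + (c + d) ≡ (a + c) + (b + d)
  +-interchange a b c d = begin
    (a + b) + (c + d)   ≡⟨ +-assoc a b _ ⟩
    a + (b + (c + d))   ≡⟨ cong (a +_) (sym (+-assoc b c d)) ⟩
    a + ((b + c) + d)   ≡⟨ cong (λ t → a + (t + d)) (+-comm b c) ⟩
    a + ((c + b) + d)   ≡⟨ cong (a +_) (+-assoc c b d) ⟩
    a + (c + (b + d))   ≡⟨ sym (+-assoc a c _) ⟩
    (a + c) + (b + d)   ∎

  -‿difference : ∀ a b c d → (a + c) + - (b + d) ≡ (a + - b) + (c + - d)
  -‿difference a b c d = trans (cong ((a + c) +_) (-‿+-distrib b d)) (+-interchange a c (- b) (- d))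

  -‿*-‿ : ∀ x y → - x * - y ≡ x * y
  -‿*-‿ x y = trans (sym (-‿distribˡ-* x (- y))) (trans (cong -_ (sym (-‿distribʳ-* x y))) (-‿involutive _))

  ⟦reduce⟧ : ∀ a b → ⟦ reduce a b ⟧ ≡ a ∙ 1# + - (b ∙ 1#)
  ⟦reduce⟧ zero    zero    = refl
  ⟦reduce⟧ zero    (suc b) = refl
  ⟦reduce⟧ (suc a) zero    = refl
  ⟦reduce⟧ (suc a) (suc b) = begin
    ⟦ reduce a b ⟧            ≡⟨ ⟦reduce⟧ a b ⟩
    A + - B                   ≡⟨ sym (+-identityˡ _) ⟩
    0# + (A + - B)            ≡⟨ cong (_+ (A + - B)) (sym (-‿inverseʳ 1#)) ⟩
    (1# + - 1#) + (A + - B)   ≡⟨ +-interchange _ _ _ _ ⟩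
    (1# + A) + (- 1# + - B)   ≡⟨ cong ((1# + A) +_) (sym (-‿+-distrib 1# B)) ⟩
    (1# + A) + - (1# + B)     ∎
    where
    A B : Carrier
    A = a ∙ 1#
    B = b ∙ 1#

  ⟦⟧-homo-+ : ∀ p q → ⟦ p ⊕ q ⟧ ≡ ⟦ p ⟧ + ⟦ q ⟧
  ⟦⟧-homo-+ (a , b) (c , d) = begin
    ⟦ reduce (a ℕ.+ c) (b ℕ.+ d) ⟧            ≡⟨ ⟦reduce⟧ (a ℕ.+ c) (b ℕ.+ d) ⟩
    (a ℕ.+ c) ∙ 1# + - ((b ℕ.+ d) ∙ 1#)       ≡⟨ cong₂ (λ s t → s + - t) (×-homo-+ 1# a c) (×-homo-+ 1# b d) ⟩
    (a ∙ 1# + c ∙ 1#) + - (b ∙ 1# + d ∙ 1#)   ≡⟨ -‿difference _ _ _ _ ⟩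
    ⟦ a , b ⟧ + ⟦ c , d ⟧                     ∎

  ⟦⟧-homo-* : ∀ p q → ⟦ p ⊛ q ⟧ ≡ ⟦ p ⟧ * ⟦ q ⟧
  ⟦⟧-homo-* (a , b) (c , d) = begin
    ⟦ reduce (a ℕ.* c ℕ.+ b ℕ.* d) (a ℕ.* d ℕ.+ b ℕ.* c) ⟧   ≡⟨ ⟦reduce⟧ (a ℕ.* c ℕ.+ b ℕ.* d) _ ⟩
    (a ℕ.* c ℕ.+ b ℕ.* d) ∙ 1# + - ((a ℕ.* d ℕ.+ b ℕ.* c) ∙ 1#)
      ≡⟨ cong₂ (λ s t → s + - t) (×-homo-sum a c b d) (×-homo-sum a d b c) ⟩
    (A * C + B * D) + - (A * D + B * C)         ≡⟨ -‿difference _ _ _ _ ⟩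
    (A * C + - (A * D)) + (B * D + - (B * C))
      ≡⟨ cong₂ _+_ (cong (A * C +_) (-‿distribʳ-* A D))
                   (trans (+-comm _ _) (cong₂ _+_ (-‿distribˡ-* B C) (sym (-‿*-‿ B D)))) ⟩
    (A * C + A * - D) + (- B * C + - B * - D)   ≡⟨ cong₂ _+_ (sym (distribˡ A C (- D))) (sym (distribˡ (- B) C (- D))) ⟩
    A * (C + - D) + - B * (C + - D)             ≡⟨ sym (distribʳ _ A (- B)) ⟩
    (A + - B) * (C + - D)                       ∎
    where
    A B C D : Carrier
    A = a ∙ 1#
    B = b ∙ 1#
    C = c ∙ 1#
    D = d ∙ 1#
    ×-homo-sum : ∀ m n m′ n′ → (m ℕ.* n ℕ.+ m′ ℕ.* n′) ∙ 1# ≡ (m ∙ 1#) * (n ∙ 1#) + (m′ ∙ 1#) * (n′ ∙ 1#)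
    ×-homo-sum m n m′ n′ = trans (×-homo-+ 1# (m ℕ.* n) _) (cong₂ _+_ (×1-homo-* m n) (×1-homo-* m′ n′))

  ⟦⟧-homo-‿ : ∀ p → ⟦ ⊝ p ⟧ ≡ - ⟦ p ⟧
  ⟦⟧-homo-‿ (a , b) = sym (trans (-‿+-distrib _ _) (trans (cong (- (a ∙ 1#) +_) (-‿involutive _)) (+-comm _ _)))

  ⟦⟧-homo : diffRing -Raw-AlmostCommutative⟶ fromCommutativeRing commutativeRing
  ⟦⟧-homo = record
    { ⟦_⟧ = ⟦_⟧ ; +-homo = ⟦⟧-homo-+ ; *-homo = ⟦⟧-homo-* ; -‿homo = ⟦⟧-homo-‿
    ; 0-homo = trans (cong (0# +_) -0#≈0#) (+-identityʳ _)
    ; 1-homo = trans (cong₂ _+_ (+-identityʳ _) -0#≈0#) (+-identityʳ _)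
    }

  ⟦⟧-≟ : ∀ p q → Maybe (⟦ p ⟧ ≡ ⟦ q ⟧)
  ⟦⟧-≟ (a , b) (c , d) with a ℕ.≟ c | b ℕ.≟ d
  ... | yes refl | yes refl = just refl
  ... | _        | _        = nothing

  open import Algebra.Solver.Ring diffRing (fromCommutativeRing commutativeRing) ⟦⟧-homo ⟦⟧-≟
    using (solve; _:=_; _:+_; _:*_; :-_)

  module STO = IsStrictTotalOrder <-isStrictTotalOrder

  <-trans : ∀ {a b c} → a < b → b < c → a < c
  <-trans = STO.trans

  ≤-<-trans : ∀ {a b c} → a ≤ b → b < c → a < c
  ≤-<-trans (inj₁ p)    q = <-trans p q
  ≤-<-trans (inj₂ refl) q = q

  0<1 : 0# < 1#
  0<1 with STO.compare 0# 1#
  ... | tri< 0<1 _ _ = 0<1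
  ... | tri≈ _ 0≡1 _ = ⊥-elim (0≢1 0≡1)
  ... | tri> _ _ 1<0 = ⊥-elim (STO.asym 1<0 (subst (0# <_) (trans (-‿*-‿ 1# 1#) (*-identityˡ _)) (*-pos 0<-1 0<-1)))
    where
    0<-1 : 0# < - 1#
    0<-1 = subst₂ _<_ (-‿inverseʳ 1#) (+-identityˡ _) (+-mono-< (- 1#) 1<0)

  x<x+y : ∀ {x y} → 0# < y → x < x + y
  x<x+y {x} {y} p = subst₂ _<_ (+-identityˡ x) (+-comm y x) (+-mono-< x p)

  +-pos-nonneg : ∀ {x y} → 0# < x → 0# ≤ y → 0# < x + y
  +-pos-nonneg {x} p (inj₁ q)    = <-trans p (x<x+y q)
  +-pos-nonneg {x} p (inj₂ refl) = subst (0# <_) (sym (+-identityʳ x)) p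

  +-nonneg-pos : ∀ {x y} → 0# ≤ x → 0# < y → 0# < x + y
  +-nonneg-pos {x} {y} p q = subst (0# <_) (+-comm y x) (+-pos-nonneg q p)

  +-nonneg : ∀ {x y} → 0# ≤ x → 0# ≤ y → 0# ≤ x + y
  +-nonneg (inj₁ p)            q = inj₁ (+-pos-nonneg p q)
  +-nonneg {y = y} (inj₂ refl) q = subst (0# ≤_) (sym (+-identityˡ y)) q

  *-nonneg : ∀ {x y} → 0# ≤ x → 0# ≤ y → 0# ≤ x * y
  *-nonneg     (inj₁ p)    (inj₁ q)    = inj₁ (*-pos p q)
  *-nonneg {x} (inj₁ p)    (inj₂ refl) = inj₂ (sym (zeroʳ x))
  *-nonneg {y = y} (inj₂ refl) q       = inj₂ (sym (zeroˡ y))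

  sgn : ℕ → Carrier
  sgn n = sign n 1#

  sign≡sgn* : ∀ n x → sign n x ≡ sgn n * x
  sign≡sgn* zero          x = sym (*-identityˡ x)
  sign≡sgn* (suc zero)    x = trans (cong -_ (sym (*-identityˡ x))) (-‿distribˡ-* 1# x)
  sign≡sgn* (suc (suc n)) x = sign≡sgn* n x

  sign-suc : ∀ n x → sign (suc n) x ≡ - sign n x
  sign-suc zero          x = refl
  sign-suc (suc zero)    x = sym (-‿involutive x)
  sign-suc (suc (suc n)) x = sign-suc n x

  sign-‿ : ∀ n x → sign n (- x) ≡ - sign n x
  sign-‿ zero          x = refl
  sign-‿ (suc zero)    x = refl
  sign-‿ (suc (suc n)) x = sign-‿ n x

  sign-zero : ∀ n → sign n 0# ≡ 0#
  sign-zero zero          = refl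
  sign-zero (suc zero)    = -0#≈0#
  sign-zero (suc (suc n)) = sign-zero n

  sumFin-cong : ∀ {k} {a b : Fin k → Carrier} → (∀ i → a i ≡ b i) → sumFin a ≡ sumFin b
  sumFin-cong {zero}  e = refl
  sumFin-cong {suc k} e = cong₂ _+_ (e zero) (sumFin-cong (λ i → e (suc i)))

  sumFin-+ : ∀ {k} (a b : Fin k → Carrier) → sumFin (λ i → a i + b i) ≡ sumFin a + sumFin b
  sumFin-+ {zero}  a b = sym (+-identityˡ 0#)
  sumFin-+ {suc k} a b = trans (cong (a zero + b zero +_) (sumFin-+ (λ i → a (suc i)) (λ i → b (suc i))))
                               (+-interchange _ _ _ _)

  *-distribˡ-sumFin : ∀ {k} c (a : Fin k → Carrier) → c * sumFin a ≡ sumFin (λ i → c * a i)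
  *-distribˡ-sumFin {zero}  c a = zeroʳ c
  *-distribˡ-sumFin {suc k} c a = trans (distribˡ c _ _) (cong (c * a zero +_) (*-distribˡ-sumFin c (λ i → a (suc i))))

  sumFin-zero : ∀ {k} (a : Fin k → Carrier) → (∀ i → a i ≡ 0#) → sumFin a ≡ 0#
  sumFin-zero {zero}  a e = refl
  sumFin-zero {suc k} a e = trans (cong₂ _+_ (e zero) (sumFin-zero (λ i → a (suc i)) (λ i → e (suc i)))) (+-identityˡ 0#)

  -‿sumFin : ∀ {k} (a : Fin k → Carrier) → - sumFin a ≡ sumFin (λ i → - a i)
  -‿sumFin {zero}  a = -0#≈0#
  -‿sumFin {suc k} a = trans (-‿+-distrib _ _) (cong (- a zero +_) (-‿sumFin (λ i → a (suc i))))

  sumRange : ℕ → ℕ → (ℕ → Carrier) → Carrier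
  sumRange lo zero    F = 0#
  sumRange lo (suc n) F = F lo + sumRange (suc lo) n F

  sumRange-cong : ∀ lo n {F G : ℕ → Carrier} → (∀ i → F i ≡ G i) → sumRange lo n F ≡ sumRange lo n G
  sumRange-cong lo zero    e = refl
  sumRange-cong lo (suc n) e = cong₂ _+_ (e lo) (sumRange-cong (suc lo) n e)

  sumRange-cong-on : ∀ lo n {F G : ℕ → Carrier} → (∀ i → lo ℕ.≤ i → i ℕ.< lo ℕ.+ n → F i ≡ G i) →
                     sumRange lo n F ≡ sumRange lo n G
  sumRange-cong-on lo zero    e = refl
  sumRange-cong-on lo (suc n) e =
    cong₂ _+_ (e lo ℕₚ.≤-refl (ℕₚ.m<m+n lo (s≤s z≤n)))
              (sumRange-cong-on (suc lo) n (λ i p q → e i (ℕₚ.<⇒≤ p) (subst (i ℕ.<_) (sym (ℕₚ.+-suc lo n)) q)))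

  sumRange-+ : ∀ lo n (F G : ℕ → Carrier) → sumRange lo n (λ i → F i + G i) ≡ sumRange lo n F + sumRange lo n G
  sumRange-+ lo zero    F G = sym (+-identityˡ 0#)
  sumRange-+ lo (suc n) F G = trans (cong (F lo + G lo +_) (sumRange-+ (suc lo) n F G)) (+-interchange _ _ _ _)

  *-distribˡ-sumRange : ∀ lo n c (F : ℕ → Carrier) → c * sumRange lo n F ≡ sumRange lo n (λ i → c * F i)
  *-distribˡ-sumRange lo zero    c F = zeroʳ c
  *-distribˡ-sumRange lo (suc n) c F = trans (distribˡ c _ _) (cong (c * F lo +_) (*-distribˡ-sumRange (suc lo) n c F))

  sumRange-zero : ∀ lo n (F : ℕ → Carrier) → (∀ i → lo ℕ.≤ i → i ℕ.< lo ℕ.+ n → F i ≡ 0#) → sumRange lo n F ≡ 0#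
  sumRange-zero lo n F e = trans (sumRange-cong-on lo n e) (zeros lo n)
    where
    zeros : ∀ lo n → sumRange lo n (λ _ → 0#) ≡ 0#
    zeros lo zero    = refl
    zeros lo (suc n) = trans (cong (0# +_) (zeros (suc lo) n)) (+-identityˡ 0#)

  sumRange-shift : ∀ lo n (F : ℕ → Carrier) → sumRange (suc lo) n F ≡ sumRange lo n (λ i → F (suc i))
  sumRange-shift lo zero    F = refl
  sumRange-shift lo (suc n) F = cong (F (suc lo) +_) (sumRange-shift (suc lo) n F)

  sumRange-split : ∀ lo a b (F : ℕ → Carrier) → sumRange lo (a ℕ.+ b) F ≡ sumRange lo a F + sumRange (lo ℕ.+ a) b F
  sumRange-split lo zero    b F = trans (cong (λ t → sumRange t b F) (sym (ℕₚ.+-identityʳ lo))) (sym (+-identityˡ _))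
  sumRange-split lo (suc a) b F = begin
    F lo + sumRange (suc lo) (a ℕ.+ b) F                             ≡⟨ cong (F lo +_) (sumRange-split (suc lo) a b F) ⟩
    F lo + (sumRange (suc lo) a F + sumRange (suc lo ℕ.+ a) b F)     ≡⟨ sym (+-assoc _ _ _) ⟩
    F lo + sumRange (suc lo) a F + sumRange (suc lo ℕ.+ a) b F       ≡⟨ cong (λ t → F lo + sumRange (suc lo) a F + sumRange t b F) (sym (ℕₚ.+-suc lo a)) ⟩
    F lo + sumRange (suc lo) a F + sumRange (lo ℕ.+ suc a) b F       ∎

  sumRange-snoc : ∀ lo n (F : ℕ → Carrier) → sumRange lo (suc n) F ≡ sumRange lo n F + F (lo ℕ.+ n)
  sumRange-snoc lo n F = begin
    sumRange lo (suc n) F                              ≡⟨ cong (λ t → sumRange lo t F) (ℕₚ.+-comm 1 n) ⟩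
    sumRange lo (n ℕ.+ 1) F                            ≡⟨ sumRange-split lo n 1 F ⟩
    sumRange lo n F + (F (lo ℕ.+ n) + 0#)              ≡⟨ cong (sumRange lo n F +_) (+-identityʳ _) ⟩
    sumRange lo n F + F (lo ℕ.+ n)                     ∎

  sumTo≡sumRange : ∀ n (F : ℕ → Carrier) → sumTo n F ≡ sumRange 0 n F
  sumTo≡sumRange zero    F = refl
  sumTo≡sumRange (suc n) F = trans (cong (_+ F n) (sumTo≡sumRange n F)) (sym (sumRange-snoc 0 n F))

  sumRange-reverse : ∀ n (F : ℕ → Carrier) → sumRange 0 (suc n) F ≡ sumRange 0 (suc n) (λ i → F (n ∸ i))
  sumRange-reverse zero    F = refl
  sumRange-reverse (suc n) F = begin
    sumRange 0 (suc (suc n)) F                            ≡⟨ sumRange-snoc 0 (suc n) F ⟩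
    sumRange 0 (suc n) F + F (suc n)                      ≡⟨ cong (_+ F (suc n)) (sumRange-reverse n F) ⟩
    sumRange 0 (suc n) (λ i → F (n ∸ i)) + F (suc n)      ≡⟨ +-comm _ _ ⟩
    F (suc n) + sumRange 0 (suc n) (λ i → F (n ∸ i))      ≡⟨ cong (F (suc n) +_) (sym (sumRange-shift 0 (suc n) (λ i → F (suc n ∸ i)))) ⟩
    sumRange 0 (suc (suc n)) (λ i → F (suc n ∸ i))        ∎

  sumFin-sumRange : ∀ {k} lo n (X : Fin k → ℕ → Carrier) →
                    sumFin (λ c → sumRange lo n (X c)) ≡ sumRange lo n (λ j → sumFin (λ c → X c j))
  sumFin-sumRange {zero}  lo n X = sym (sumRange-zero lo n _ (λ _ _ _ → refl))
  sumFin-sumRange {suc k} lo n X = trans (cong (sumRange lo n (X zero) +_) (sumFin-sumRange lo n (λ c → X (suc c))))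
                                         (sym (sumRange-+ lo n _ _))

  Extensional : ∀ {A : Set} {k} → ((Fin k → A) → Carrier) → Set
  Extensional F = ∀ σ τ → (∀ i → σ i ≡ τ i) → F σ ≡ F τ

  -- The sum of F J over the strictly increasing J : Fin k → ℕ with values in [lo, lo + n).
  sumIncreasing : (k : ℕ) → ℕ → ℕ → ((Fin k → ℕ) → Carrier) → Carrier
  sumIncreasing zero    lo n       F = F []
  sumIncreasing (suc k) lo zero    F = 0#
  sumIncreasing (suc k) lo (suc n) F = sumIncreasing k (suc lo) n (λ J → F (lo ∷ J)) + sumIncreasing (suc k) (suc lo) n F

  sumIncreasing-cong : ∀ k lo n {F G : (Fin k → ℕ) → Carrier} → (∀ J → F J ≡ G J) →
                       sumIncreasing k lo n F ≡ sumIncreasing k lo n G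
  sumIncreasing-cong zero    lo n       e = e _
  sumIncreasing-cong (suc k) lo zero    e = refl
  sumIncreasing-cong (suc k) lo (suc n) e =
    cong₂ _+_ (sumIncreasing-cong k (suc lo) n (λ J → e _)) (sumIncreasing-cong (suc k) (suc lo) n e)

  sumIncreasing-+ : ∀ k lo n (F G : (Fin k → ℕ) → Carrier) →
                    sumIncreasing k lo n (λ J → F J + G J) ≡ sumIncreasing k lo n F + sumIncreasing k lo n G
  sumIncreasing-+ zero    lo n       F G = refl
  sumIncreasing-+ (suc k) lo zero    F G = sym (+-identityˡ 0#)
  sumIncreasing-+ (suc k) lo (suc n) F G =
    trans (cong₂ _+_ (sumIncreasing-+ k (suc lo) n _ _) (sumIncreasing-+ (suc k) (suc lo) n F G)) (+-interchange _ _ _ _)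

  *-distribˡ-sumIncreasing : ∀ k lo n c (F : (Fin k → ℕ) → Carrier) →
                             c * sumIncreasing k lo n F ≡ sumIncreasing k lo n (λ J → c * F J)
  *-distribˡ-sumIncreasing zero    lo n       c F = refl
  *-distribˡ-sumIncreasing (suc k) lo zero    c F = zeroʳ c
  *-distribˡ-sumIncreasing (suc k) lo (suc n) c F =
    trans (distribˡ c _ _) (cong₂ _+_ (*-distribˡ-sumIncreasing k (suc lo) n c _) (*-distribˡ-sumIncreasing (suc k) (suc lo) n c F))

  sumIncreasing-zero : ∀ k lo n → sumIncreasing k lo n (λ _ → 0#) ≡ 0#
  sumIncreasing-zero zero    lo n       = refl
  sumIncreasing-zero (suc k) lo zero    = refl
  sumIncreasing-zero (suc k) lo (suc n) =
    trans (cong₂ _+_ (sumIncreasing-zero k (suc lo) n) (sumIncreasing-zero (suc k) (suc lo) n)) (+-identityˡ 0#)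

  sumFin-sumIncreasing : ∀ {m} k lo n (X : Fin m → (Fin k → ℕ) → Carrier) →
                         sumFin (λ c → sumIncreasing k lo n (X c)) ≡ sumIncreasing k lo n (λ J → sumFin (λ c → X c J))
  sumFin-sumIncreasing {zero}  k lo n X = sym (sumIncreasing-zero k lo n)
  sumFin-sumIncreasing {suc m} k lo n X =
    trans (cong (sumIncreasing k lo n (X zero) +_) (sumFin-sumIncreasing k lo n (λ c → X (suc c))))
          (sym (sumIncreasing-+ k lo n _ _))

  Increasing-∷ : ∀ {k} (a : ℕ) (J : Fin k → ℕ) → Increasing J → (∀ l → a ℕ.< J l) → Increasing (a ∷ J)
  Increasing-∷ a J inc lt zero    zero    ()
  Increasing-∷ a J inc lt zero    (suc j) _       = lt j
  Increasing-∷ a J inc lt (suc i) zero    ()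
  Increasing-∷ a J inc lt (suc i) (suc j) (s≤s p) = inc i j p

  Increasing-tail : ∀ {k} (J : Fin (suc k) → ℕ) → Increasing J → Increasing (λ i → J (suc i))
  Increasing-tail J inc i j p = inc (suc i) (suc j) (s≤s p)

  Increasing-head : ∀ {k} (J : Fin (suc k) → ℕ) → Increasing J → ∀ l → J zero ℕ.< J (suc l)
  Increasing-head J inc l = inc zero (suc l) (s≤s z≤n)

  Increasing-mono : ∀ {k} (J : Fin k → ℕ) → Increasing J → ∀ i j → toℕ i ℕ.≤ toℕ j → J i ℕ.≤ J j
  Increasing-mono J inc i j p with ℕₚ.m≤n⇒m<n∨m≡n p
  ... | inj₁ q = ℕₚ.<⇒≤ (inc i j q)
  ... | inj₂ q = ℕₚ.≤-reflexive (cong J (Finₚ.toℕ-injective q))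

  InRange : ∀ {k} → ℕ → ℕ → (Fin k → ℕ) → Set
  InRange lo n J = Increasing J × (∀ l → lo ℕ.≤ J l) × (∀ l → J l ℕ.< lo ℕ.+ n)

  InRange-∷ : ∀ {k} lo n (J : Fin k → ℕ) → InRange (suc lo) n J → InRange lo (suc n) (lo ∷ J)
  InRange-∷ lo n J (inc , lb , ub) =
    Increasing-∷ lo J inc lb ,
    (λ { zero → ℕₚ.≤-refl ; (suc l) → ℕₚ.<⇒≤ (lb l) }) ,
    (λ { zero → ℕₚ.m<m+n lo (s≤s z≤n) ; (suc l) → subst (J l ℕ.<_) (sym (ℕₚ.+-suc lo n)) (ub l) })

  InRange-widen : ∀ {k} lo n (J : Fin k → ℕ) → InRange (suc lo) n J → InRange lo (suc n) J
  InRange-widen lo n J (inc , lb , ub) = inc , (λ l → ℕₚ.<⇒≤ (lb l)) , (λ l → subst (J l ℕ.<_) (sym (ℕₚ.+-suc lo n)) (ub l))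

  sumIncreasing-nonneg : ∀ k lo n (F : (Fin k → ℕ) → Carrier) → (∀ J → InRange lo n J → 0# ≤ F J) →
                         0# ≤ sumIncreasing k lo n F
  sumIncreasing-nonneg zero    lo n       F h = h _ ((λ ()) , (λ ()) , (λ ()))
  sumIncreasing-nonneg (suc k) lo zero    F h = inj₂ refl
  sumIncreasing-nonneg (suc k) lo (suc n) F h =
    +-nonneg (sumIncreasing-nonneg k (suc lo) n _ (λ J r → h (lo ∷ J) (InRange-∷ lo n J r)))
             (sumIncreasing-nonneg (suc k) (suc lo) n F (λ J r → h J (InRange-widen lo n J r)))

  sumIncreasing-pos : ∀ k lo n (F : (Fin k → ℕ) → Carrier) → Extensional F → (∀ J → InRange lo n J → 0# ≤ F J) →
                      (J₀ : Fin k → ℕ) → InRange lo n J₀ → 0# < F J₀ → 0# < sumIncreasing k lo n F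
  sumIncreasing-pos zero lo n F ext h J₀ r p = subst (0# <_) (ext J₀ _ (λ ())) p
  sumIncreasing-pos (suc k) lo zero F ext h J₀ (_ , lb , ub) p =
    ⊥-elim (ℕₚ.<-irrefl refl (ℕₚ.≤-<-trans (lb zero) (subst (J₀ zero ℕ.<_) (ℕₚ.+-identityʳ lo) (ub zero))))
  sumIncreasing-pos (suc k) lo (suc n) F ext h J₀ (inc , lb , ub) p with J₀ zero ℕ.≟ lo
  ... | yes J₀0≡lo =
    +-pos-nonneg
      (sumIncreasing-pos k (suc lo) n (λ J → F (lo ∷ J)) (λ J J′ e → ext _ _ (λ { zero → refl ; (suc i) → e i }))
        (λ J r → h (lo ∷ J) (InRange-∷ lo n J r))
        (λ i → J₀ (suc i))
        (Increasing-tail J₀ inc ,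
         (λ l → subst (ℕ._< J₀ (suc l)) J₀0≡lo (Increasing-head J₀ inc l)) ,
         (λ l → subst (J₀ (suc l) ℕ.<_) (ℕₚ.+-suc lo n) (ub (suc l))))
        (subst (0# <_) (ext J₀ _ (λ { zero → J₀0≡lo ; (suc i) → refl })) p))
      (sumIncreasing-nonneg (suc k) (suc lo) n F (λ J r → h J (InRange-widen lo n J r)))
  ... | no J₀0≢lo =
    +-nonneg-pos
      (sumIncreasing-nonneg k (suc lo) n _ (λ J r → h (lo ∷ J) (InRange-∷ lo n J r)))
      (sumIncreasing-pos (suc k) (suc lo) n F ext (λ J r → h J (InRange-widen lo n J r)) J₀
        (inc , lb′ , (λ l → subst (J₀ l ℕ.<_) (ℕₚ.+-suc lo n) (ub l))) p)
    where
    lo<J₀0 : lo ℕ.< J₀ zero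
    lo<J₀0 = ℕₚ.≤∧≢⇒< (lb zero) (λ q → J₀0≢lo (sym q))
    lb′ : ∀ l → suc lo ℕ.≤ J₀ l
    lb′ zero    = lo<J₀0
    lb′ (suc l) = ℕₚ.<⇒≤ (ℕₚ.≤-<-trans lo<J₀0 (Increasing-head J₀ inc l))

  -- The determinant is alternating in its rows

  det-cong : ∀ k {M N : Fin k → Fin k → Carrier} → (∀ r c → M r c ≡ N r c) → det k M ≡ det k N
  det-cong zero    e = refl
  det-cong (suc k) e =
    sumFin-cong (λ j → cong (sign (toℕ j)) (cong₂ _*_ (e zero j) (det-cong k (λ r c → e (suc r) (punchIn j c)))))

  -- Laplace expansion along two rows u, v; Q gives the complementary minor for an
  -- injection of the remaining columns.
  laplace₂ : ∀ {k} (u v : Fin (suc (suc k)) → Carrier) (Q : (Fin k → Fin (suc (suc k))) → Carrier) → Carrier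
  laplace₂ u v Q =
    sumFin (λ c → sign (toℕ c) (u c * sumFin (λ d → sign (toℕ d) (v (punchIn c d) * Q (λ e → punchIn c (punchIn d e))))))

  laplace₁-tail : ∀ {k} (Q : (Fin k → Fin (suc (suc k))) → Carrier) → (Fin (suc (suc k)) → Carrier) → Carrier
  laplace₁-tail Q w = sumFin (λ d → sign (toℕ d) (w (suc d) * Q (λ e → suc (punchIn d e))))

  restrict : ∀ {k} → ((Fin (suc k) → Fin (suc (suc (suc k)))) → Carrier) → (Fin k → Fin (suc (suc k))) → Carrier
  restrict Q τ = Q (zero ∷ (λ e → suc (τ e)))

  restrict-ext : ∀ {k} (Q : (Fin (suc k) → Fin (suc (suc (suc k)))) → Carrier) → Extensional Q → Extensional (restrict Q)
  restrict-ext Q ext σ τ e = ext _ _ (λ { zero → refl ; (suc i) → cong suc (e i) })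

  laplace₂-expand : ∀ {k} (u v : Fin (suc (suc (suc k))) → Carrier) Q → Extensional Q →
                    laplace₂ u v Q ≡ u zero * laplace₁-tail Q v +
                      (- (v zero * laplace₁-tail Q u) + laplace₂ (λ i → u (suc i)) (λ i → v (suc i)) (restrict Q))
  laplace₂-expand {k} u v Q ext =
    cong (u zero * laplace₁-tail Q v +_)
      (trans (sumFin-cong column) (trans (sumFin-+ (λ c → - (v zero * W c)) V) (cong (_+ sumFin V) first)))
    where
    W : Fin (suc (suc k)) → Carrier
    W c = sign (toℕ c) (u (suc c) * Q (λ e → suc (punchIn c e)))
    Z : Fin (suc (suc k)) → Carrier
    Z c = sumFin (λ d → sign (toℕ d) (v (suc (punchIn c d)) * restrict Q (λ e → punchIn c (punchIn d e))))
    V : Fin (suc (suc k)) → Carrier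
    V c = sign (toℕ c) (u (suc c) * Z c)
    first : sumFin (λ c → - (v zero * W c)) ≡ - (v zero * laplace₁-tail Q u)
    first = trans (sym (-‿sumFin (λ c → v zero * W c))) (cong -_ (sym (*-distribˡ-sumFin (v zero) W)))
    regroup : ∀ s a b q z → - (s * (a * (b * q + - z))) ≡ - (b * (s * (a * q))) + s * (a * z)
    regroup = solve 5 (λ s a b q z → :- (s :* (a :* (b :* q :+ :- z))) := :- (b :* (s :* (a :* q))) :+ s :* (a :* z)) refl
    column : ∀ c → sign (suc (toℕ c)) (u (suc c) * (v zero * Q (λ e → suc (punchIn c e)) +
                     sumFin (λ d → sign (suc (toℕ d)) (v (suc (punchIn c d)) * Q (λ e → punchIn (suc c) (punchIn (suc d) e))))))
                   ≡ - (v zero * W c) + V c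
    column c = begin
      sign (suc (toℕ c)) (u (suc c) * (v zero * Q (λ e → suc (punchIn c e)) + sumFin (λ d → sign (suc (toℕ d))
        (v (suc (punchIn c d)) * Q (λ e → punchIn (suc c) (punchIn (suc d) e))))))
        ≡⟨ cong (λ t → sign (suc (toℕ c)) (u (suc c) * (v zero * Q (λ e → suc (punchIn c e)) + t))) inner ⟩
      sign (suc (toℕ c)) (u (suc c) * (v zero * Q (λ e → suc (punchIn c e)) + - Z c))
        ≡⟨ trans (sign-suc (toℕ c) _) (cong -_ (sign≡sgn* (toℕ c) _)) ⟩
      - (sgn (toℕ c) * (u (suc c) * (v zero * Q (λ e → suc (punchIn c e)) + - Z c)))
        ≡⟨ regroup _ _ _ _ _ ⟩
      - (v zero * (sgn (toℕ c) * (u (suc c) * Q (λ e → suc (punchIn c e))))) + sgn (toℕ c) * (u (suc c) * Z c)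
        ≡⟨ cong₂ (λ a b → - (v zero * a) + b) (sym (sign≡sgn* (toℕ c) _)) (sym (sign≡sgn* (toℕ c) _)) ⟩
      - (v zero * W c) + V c ∎
      where
      inner : sumFin (λ d → sign (suc (toℕ d)) (v (suc (punchIn c d)) * Q (λ e → punchIn (suc c) (punchIn (suc d) e)))) ≡ - Z c
      inner = trans (sumFin-cong (λ d → trans (sign-suc (toℕ d) _) (cong (λ t → - sign (toℕ d) (v (suc (punchIn c d)) * t))
                        (ext (λ e → punchIn (suc c) (punchIn (suc d) e)) (zero ∷ (λ e → suc (punchIn c (punchIn d e))))
                             (λ { zero → refl ; (suc e) → refl })))))
                    (sym (-‿sumFin (λ d → sign (toℕ d) (v (suc (punchIn c d)) * restrict Q (λ e → punchIn c (punchIn d e))))))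

  laplace₂-base : ∀ (u v : Fin 2 → Carrier) Q → Extensional Q →
                  laplace₂ u v Q ≡ u zero * (v (suc zero) * Q []) + - (u (suc zero) * (v zero * Q []))
  laplace₂-base u v Q ext =
    trans (cong₂ (λ s t → u zero * (v (suc zero) * s + 0#) + (- (u (suc zero) * (v zero * t + 0#)) + 0#))
                 (ext _ _ (λ ())) (ext _ _ (λ ())))
          drop-zeros
    where
    drop-zeros : ∀ {a b c d p q} → a * (b * p + 0#) + (- (c * (d * q + 0#)) + 0#) ≡ a * (b * p) + - (c * (d * q))
    drop-zeros {a} {b} {c} {d} {p} {q} = trans (cong (a * (b * p + 0#) +_) (+-identityʳ (- (c * (d * q + 0#)))))
                                       (cong₂ (λ s t → a * s + - (c * t)) (+-identityʳ _) (+-identityʳ _))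

  laplace₂-antisym : ∀ {k} (u v : Fin (suc (suc k)) → Carrier) Q → Extensional Q → laplace₂ u v Q ≡ - laplace₂ v u Q
  laplace₂-antisym {zero} u v Q ext =
    trans (laplace₂-base u v Q ext) (trans (swap _ _ _ _ _) (cong -_ (sym (laplace₂-base v u Q ext))))
    where
    swap : ∀ a b c d q → a * (b * q) + - (c * (d * q)) ≡ - (d * (c * q) + - (b * (a * q)))
    swap = solve 5 (λ a b c d q → a :* (b :* q) :+ :- (c :* (d :* q)) := :- (d :* (c :* q) :+ :- (b :* (a :* q)))) refl
  laplace₂-antisym {suc k} u v Q ext = begin
    laplace₂ u v Q                                                  ≡⟨ laplace₂-expand u v Q ext ⟩
    u zero * X v + (- (v zero * X u) + laplace₂ u′ v′ (restrict Q))  ≡⟨ cong (λ t → u zero * X v + (- (v zero * X u) + t))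
                                                                            (laplace₂-antisym u′ v′ (restrict Q) (restrict-ext Q ext)) ⟩
    u zero * X v + (- (v zero * X u) + - laplace₂ v′ u′ (restrict Q)) ≡⟨ swap _ _ _ _ _ ⟩
    - (v zero * X u + (- (u zero * X v) + laplace₂ v′ u′ (restrict Q))) ≡⟨ cong -_ (sym (laplace₂-expand v u Q ext)) ⟩
    - laplace₂ v u Q                                                ∎
    where
    u′ v′ : Fin (suc (suc k)) → Carrier
    u′ i = u (suc i)
    v′ i = v (suc i)
    X : (Fin (suc (suc (suc k))) → Carrier) → Carrier
    X = laplace₁-tail Q
    swap : ∀ a c x y p → a * x + (- (c * y) + - p) ≡ - (c * y + (- (a * x) + p))
    swap = solve 5 (λ a c x y p → a :* x :+ (:- (c :* y) :+ :- p) := :- (c :* y :+ (:- (a :* x) :+ p))) refl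

  laplace₂-diag : ∀ {k} (u : Fin (suc (suc k)) → Carrier) Q → Extensional Q → laplace₂ u u Q ≡ 0#
  laplace₂-diag {zero} u Q ext = trans (laplace₂-base u u Q ext) (cancel _ _ _)
    where
    cancel : ∀ a b q → a * (b * q) + - (b * (a * q)) ≡ 0#
    cancel a b q = trans (cong (_+ - (b * (a * q))) (solve 3 (λ a b q → a :* (b :* q) := b :* (a :* q)) refl a b q))
                         (-‿inverseʳ _)
  laplace₂-diag {suc k} u Q ext =
    trans (laplace₂-expand u u Q ext) (trans (cancel _ _ _) (laplace₂-diag (λ i → u (suc i)) (restrict Q) (restrict-ext Q ext)))
    where
    cancel : ∀ a x p → a * x + (- (a * x) + p) ≡ p
    cancel = solve 3 (λ a x p → a :* x :+ (:- (a :* x) :+ p) := p) refl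

  -- Alternation is only required at the first two arguments, recursively in every
  -- section D (a ∷ _).
  Alternating : (k : ℕ) → ((Fin k → ℕ) → Carrier) → Set
  Alternating zero          D = ⊤
  Alternating (suc zero)    D = ⊤
  Alternating (suc (suc k)) D = (∀ j a L → D (j ∷ a ∷ L) ≡ - D (a ∷ j ∷ L)) × (∀ a L → D (a ∷ a ∷ L) ≡ 0#)
                                × (∀ a → Alternating (suc k) (λ L → D (a ∷ L)))

  Alternating-cong : ∀ k {D D′ : (Fin k → ℕ) → Carrier} → (∀ L → D L ≡ D′ L) → Alternating k D → Alternating k D′
  Alternating-cong zero          e _ = tt
  Alternating-cong (suc zero)    e _ = tt
  Alternating-cong (suc (suc k)) e (swap , diag , section) =
    (λ j a L → trans (sym (e _)) (trans (swap j a L) (cong -_ (e _)))) ,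
    (λ a L → trans (sym (e _)) (diag a L)) ,
    (λ a → Alternating-cong (suc k) (λ L → e _) (section a))

  Alternating-zero : ∀ k → Alternating k (λ _ → 0#)
  Alternating-zero zero          = tt
  Alternating-zero (suc zero)    = tt
  Alternating-zero (suc (suc k)) = (λ _ _ _ → sym -0#≈0#) , (λ _ _ → refl) , (λ _ → Alternating-zero (suc k))

  Alternating-+ : ∀ k {D₁ D₂ : (Fin k → ℕ) → Carrier} → Alternating k D₁ → Alternating k D₂ →
                  Alternating k (λ L → D₁ L + D₂ L)
  Alternating-+ zero          _ _ = tt
  Alternating-+ (suc zero)    _ _ = tt
  Alternating-+ (suc (suc k)) (swap₁ , diag₁ , section₁) (swap₂ , diag₂ , section₂) =
    (λ j a L → trans (cong₂ _+_ (swap₁ j a L) (swap₂ j a L)) (sym (-‿+-distrib _ _))) ,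
    (λ a L → trans (cong₂ _+_ (diag₁ a L) (diag₂ a L)) (+-identityˡ 0#)) ,
    (λ a → Alternating-+ (suc k) (section₁ a) (section₂ a))

  Alternating-* : ∀ k c {D : (Fin k → ℕ) → Carrier} → Alternating k D → Alternating k (λ L → c * D L)
  Alternating-* zero          c _ = tt
  Alternating-* (suc zero)    c _ = tt
  Alternating-* (suc (suc k)) c (swap , diag , section) =
    (λ j a L → trans (cong (c *_) (swap j a L)) (sym (-‿distribʳ-* c _))) ,
    (λ a L → trans (cong (c *_) (diag a L)) (zeroʳ c)) ,
    (λ a → Alternating-* (suc k) c (section a))

  Alternating-sumFin : ∀ k {m} (D : Fin m → (Fin k → ℕ) → Carrier) → (∀ c → Alternating k (D c)) →
                       Alternating k (λ L → sumFin (λ c → D c L))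
  Alternating-sumFin k {zero}  D alt = Alternating-zero k
  Alternating-sumFin k {suc m} D alt = Alternating-+ k (alt zero) (Alternating-sumFin k (λ c → D (suc c)) (λ c → alt (suc c)))

  det-alternating : ∀ k (B : ℕ → Fin k → Carrier) → Alternating k (λ L → det k (λ r c → B (L r) c))
  det-alternating zero          B = tt
  det-alternating (suc zero)    B = tt
  det-alternating (suc (suc k)) B =
    (λ j a L → laplace₂-antisym (B j) (B a) (minorOf L) (minorOf-ext L)) ,
    (λ a L → laplace₂-diag (B a) (minorOf L) (minorOf-ext L)) ,
    (λ a → Alternating-sumFin (suc k) _ (λ c →
       Alternating-cong (suc k) (λ L → sym (sign≡sgn* (toℕ c) _))
         (Alternating-* (suc k) (sgn (toℕ c)) (Alternating-* (suc k) (B a c) (det-alternating (suc k) (λ i c′ → B i (punchIn c c′)))))))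
    where
    minorOf : (Fin k → ℕ) → (Fin k → Fin (suc (suc k))) → Carrier
    minorOf L σ = det k (λ r e → B (L r) (σ e))
    minorOf-ext : ∀ L → Extensional (minorOf L)
    minorOf-ext L σ τ e = det-cong k (λ r c → cong (B (L r)) (e c))

  -- Cauchy–Binet

  -- The coefficient with which D K collects the terms g j J · D (j ∷ J) for j ∷ J a
  -- permutation of K.
  expandFirst : ∀ {k} → (ℕ → (Fin k → ℕ) → Carrier) → ((Fin (suc k) → ℕ) → Carrier) → (Fin (suc k) → ℕ) → Carrier
  expandFirst g D K = sumFin (λ p → sign (toℕ p) (g (K p) (λ e → K (punchIn p e)))) * D K

  expandFirst-∷ : ∀ {k} lo (g : ℕ → (Fin (suc k) → ℕ) → Carrier) (D : (Fin (suc (suc k)) → ℕ) → Carrier) →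
                  (∀ j → Extensional (g j)) → ∀ K →
                  expandFirst g D (lo ∷ K) ≡ g lo K * D (lo ∷ K) + expandFirst (λ j J → - g j (lo ∷ J)) (λ L → D (lo ∷ L)) K
  expandFirst-∷ lo g D ext K = trans (cong (_* D (lo ∷ K)) (cong (g lo K +_) (sumFin-cong later))) (distribʳ _ _ _)
    where
    later : ∀ q → sign (suc (toℕ q)) (g (K q) (λ e → (lo ∷ K) (punchIn (suc q) e))) ≡ sign (toℕ q) (- g (K q) (lo ∷ (λ e → K (punchIn q e))))
    later q = trans (sign-suc (toℕ q) _)
                    (trans (cong (λ t → - sign (toℕ q) t) (ext _ _ _ (λ { zero → refl ; (suc i) → refl })))
                           (sym (sign-‿ (toℕ q) _)))

  -- Terms with j ∈ J vanish since D is alternating; the others are moved into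
  -- increasing order, which only costs signs.
  sumRange-sumIncreasing-alternating :
    ∀ n k lo (g : ℕ → (Fin k → ℕ) → Carrier) (D : (Fin (suc k) → ℕ) → Carrier) →
    (∀ j → Extensional (g j)) → Alternating (suc k) D →
    sumRange lo n (λ j → sumIncreasing k lo n (λ J → g j J * D (j ∷ J))) ≡ sumIncreasing (suc k) lo n (expandFirst g D)
  sumRange-sumIncreasing-alternating zero    k       lo g D ext alt = refl
  sumRange-sumIncreasing-alternating (suc n) zero    lo g D ext alt =
    cong₂ _+_ (cong (_* D (lo ∷ [])) (sym (trans (+-identityʳ _) (ext lo _ _ (λ ())))))
              (sumRange-sumIncreasing-alternating n zero (suc lo) g D ext alt)
  sumRange-sumIncreasing-alternating (suc n) (suc k) lo g D ext (swap , diag , section) = begin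
    (A₁ + A₂) + sumRange (suc lo) n (λ j → A₃ j + A₄ j)
      ≡⟨ cong₂ _+_ (trans (cong (_+ A₂) A₁≡0) (+-identityˡ A₂)) (sumRange-+ (suc lo) n A₃ A₄) ⟩
    A₂ + (sumRange (suc lo) n A₃ + sumRange (suc lo) n A₄)
      ≡⟨ cong (λ t → A₂ + (t + sumRange (suc lo) n A₄)) A₃-swap ⟩
    A₂ + (sumRange (suc lo) n A₃′ + sumRange (suc lo) n A₄)
      ≡⟨ cong₂ (λ s t → A₂ + (s + t)) (sumRange-sumIncreasing-alternating n k (suc lo) g′ D′ ext′ (section lo))
                                      (sumRange-sumIncreasing-alternating n (suc k) (suc lo) g D ext (swap , diag , section)) ⟩
    A₂ + (sumIncreasing (suc k) (suc lo) n (expandFirst g′ D′) + sumIncreasing (suc (suc k)) (suc lo) n (expandFirst g D))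
      ≡⟨ sym (+-assoc _ _ _) ⟩
    (A₂ + sumIncreasing (suc k) (suc lo) n (expandFirst g′ D′)) + sumIncreasing (suc (suc k)) (suc lo) n (expandFirst g D)
      ≡⟨ cong (_+ sumIncreasing (suc (suc k)) (suc lo) n (expandFirst g D))
              (sym (trans (sumIncreasing-cong (suc k) (suc lo) n (expandFirst-∷ lo g D ext)) (sumIncreasing-+ (suc k) (suc lo) n _ _))) ⟩
    sumIncreasing (suc k) (suc lo) n (λ K → expandFirst g D (lo ∷ K)) + sumIncreasing (suc (suc k)) (suc lo) n (expandFirst g D) ∎
    where
    G : ℕ → (Fin (suc k) → ℕ) → Carrier
    G j J = g j J * D (j ∷ J)
    A₁ A₂ : Carrier
    A₁ = sumIncreasing k (suc lo) n (λ J → G lo (lo ∷ J))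
    A₂ = sumIncreasing (suc k) (suc lo) n (G lo)
    A₃ A₄ : ℕ → Carrier
    A₃ j = sumIncreasing k (suc lo) n (λ J → G j (lo ∷ J))
    A₄ j = sumIncreasing (suc k) (suc lo) n (G j)
    g′ : ℕ → (Fin k → ℕ) → Carrier
    g′ j J = - g j (lo ∷ J)
    D′ : (Fin (suc k) → ℕ) → Carrier
    D′ L = D (lo ∷ L)
    ext′ : ∀ j → Extensional (g′ j)
    ext′ j J J′ e = cong -_ (ext j _ _ (λ { zero → refl ; (suc i) → e i }))
    A₃′ : ℕ → Carrier
    A₃′ j = sumIncreasing k (suc lo) n (λ J → g′ j J * D′ (j ∷ J))
    A₁≡0 : A₁ ≡ 0#
    A₁≡0 = trans (sumIncreasing-cong k (suc lo) n (λ J → trans (cong (g lo (lo ∷ J) *_) (diag lo J)) (zeroʳ _)))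
                 (sumIncreasing-zero k (suc lo) n)
    A₃-swap : sumRange (suc lo) n A₃ ≡ sumRange (suc lo) n A₃′
    A₃-swap = sumRange-cong (suc lo) n (λ j → sumIncreasing-cong k (suc lo) n (λ J →
                trans (cong (g j (lo ∷ J) *_) (swap j lo J)) (trans (sym (-‿distribʳ-* _ _)) (-‿distribˡ-* _ _))))

  sumRange-*-sumIncreasing : ∀ k lo m (x : ℕ → Carrier) (y : (Fin k → ℕ) → Carrier) →
                             sumRange lo m x * sumIncreasing k lo m y ≡
                             sumRange lo m (λ j → sumIncreasing k lo m (λ J → x j * y J))
  sumRange-*-sumIncreasing k lo m x y =
    trans (*-comm _ _) (trans (*-distribˡ-sumRange lo m _ x)
      (sumRange-cong lo m (λ j → trans (*-comm _ _) (*-distribˡ-sumIncreasing k lo m (x j) y))))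

  cauchy-binet : ∀ k lo m (A : Fin k → ℕ → Carrier) (B : ℕ → Fin k → Carrier) →
                 det k (λ r c → sumRange lo m (λ j → A r j * B j c)) ≡
                 sumIncreasing k lo m (λ K → det k (λ r c → A r (K c)) * det k (λ r c → B (K r) c))
  cauchy-binet zero    lo m A B = sym (*-identityˡ 1#)
  cauchy-binet (suc k) lo m A B = begin
    sumFin (λ c → sign (toℕ c) (AB₀ c * det k (λ r c′ → sumRange lo m (λ j → A (suc r) j * B j (punchIn c c′)))))
      ≡⟨ sumFin-cong (λ c → trans (sign≡sgn* (toℕ c) _) (cong (λ t → sgn (toℕ c) * (AB₀ c * t))
                        (cauchy-binet k lo m (λ r → A (suc r)) (λ j c′ → B j (punchIn c c′))))) ⟩
    sumFin (λ c → sgn (toℕ c) * (AB₀ c * sumIncreasing k lo m (λ J → detA′ J * detB′ c J)))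
      ≡⟨ sumFin-cong (λ c → trans (cong (sgn (toℕ c) *_) (sumRange-*-sumIncreasing k lo m (λ j → A zero j * B j c) (λ J → detA′ J * detB′ c J)))
                                   (trans (*-distribˡ-sumRange lo m _ _) (sumRange-cong lo m (λ j → *-distribˡ-sumIncreasing k lo m _ _)))) ⟩
    sumFin (λ c → sumRange lo m (λ j → sumIncreasing k lo m (term c j)))
      ≡⟨ sumFin-sumRange lo m (λ c j → sumIncreasing k lo m (term c j)) ⟩
    sumRange lo m (λ j → sumFin (λ c → sumIncreasing k lo m (term c j)))
      ≡⟨ sumRange-cong lo m (λ j → sumFin-sumIncreasing k lo m (λ c → term c j)) ⟩
    sumRange lo m (λ j → sumIncreasing k lo m (λ J → sumFin (λ c → term c j J)))
      ≡⟨ sumRange-cong lo m (λ j → sumIncreasing-cong k lo m (regroup j)) ⟩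
    sumRange lo m (λ j → sumIncreasing k lo m (λ J → g j J * detB (j ∷ J)))
      ≡⟨ sumRange-sumIncreasing-alternating m k lo g detB g-ext (det-alternating (suc k) B) ⟩
    sumIncreasing (suc k) lo m (expandFirst g detB) ∎
    where
    AB₀ : Fin (suc k) → Carrier
    AB₀ c = sumRange lo m (λ j → A zero j * B j c)
    detA′ : (Fin k → ℕ) → Carrier
    detA′ J = det k (λ r c → A (suc r) (J c))
    detB′ : Fin (suc k) → (Fin k → ℕ) → Carrier
    detB′ c J = det k (λ r c′ → B (J r) (punchIn c c′))
    detB : (Fin (suc k) → ℕ) → Carrier
    detB L = det (suc k) (λ r c → B (L r) c)
    term : Fin (suc k) → ℕ → (Fin k → ℕ) → Carrier
    term c j J = sgn (toℕ c) * ((A zero j * B j c) * (detA′ J * detB′ c J))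
    g : ℕ → (Fin k → ℕ) → Carrier
    g j J = A zero j * detA′ J
    g-ext : ∀ j → Extensional (g j)
    g-ext j J J′ e = cong (A zero j *_) (det-cong k (λ r c → cong (A (suc r)) (e c)))
    rearrange : ∀ s a b d e → s * ((a * b) * (d * e)) ≡ (a * d) * (s * (b * e))
    rearrange = solve 5 (λ s a b d e → s :* ((a :* b) :* (d :* e)) := (a :* d) :* (s :* (b :* e))) refl
    regroup : ∀ j J → sumFin (λ c → term c j J) ≡ g j J * detB (j ∷ J)
    regroup j J = trans (sumFin-cong (λ c → trans (rearrange (sgn (toℕ c)) (A zero j) (B j c) (detA′ J) (detB′ c J)) (cong (g j J *_) (sym (sign≡sgn* (toℕ c) _)))))
                        (sym (*-distribˡ-sumFin (g j J) (λ c → sign (toℕ c) (B j c * detB′ c J))))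

  sign-*-zeroˡ : ∀ n x y → x ≡ 0# → sign n (x * y) ≡ 0#
  sign-*-zeroˡ n _ y refl = trans (cong (sign n) (zeroˡ y)) (sign-zero n)

  sign-*-zeroʳ : ∀ n x y → y ≡ 0# → sign n (x * y) ≡ 0#
  sign-*-zeroʳ n x _ refl = trans (cong (sign n) (zeroʳ x)) (sign-zero n)

  det-row₀ : ∀ k (M : Fin (suc k) → Fin (suc k) → Carrier) → (∀ c → M zero (suc c) ≡ 0#) →
             det (suc k) M ≡ M zero zero * det k (λ r c → M (suc r) (suc c))
  det-row₀ k M z = trans (cong (M zero zero * det k (λ r c → M (suc r) (suc c)) +_) (sumFin-zero later (λ c → sign-*-zeroˡ (toℕ (suc c)) _ _ (z c))))
                         (+-identityʳ _)
    where
    later : Fin k → Carrier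
    later c = sign (toℕ (suc c)) (M zero (suc c) * det k (λ r c′ → M (suc r) (punchIn (suc c) c′)))

  det-col₀ : ∀ k (M : Fin (suc k) → Fin (suc k) → Carrier) → (∀ r → M (suc r) zero ≡ 0#) →
             det (suc k) M ≡ M zero zero * det k (λ r c → M (suc r) (suc c))
  det-col₀ zero    M z = +-identityʳ _
  det-col₀ (suc k) M z = trans (cong (M zero zero * det (suc k) (λ r c → M (suc r) (suc c)) +_)
                                     (sumFin-zero later (λ c → sign-*-zeroʳ (toℕ (suc c)) _ _ (det-zero-col (λ r c′ → M (suc r) (punchIn (suc c) c′)) z))))
                               (+-identityʳ _)
    where
    later : Fin (suc k) → Carrier
    later c = sign (toℕ (suc c)) (M zero (suc c) * det (suc k) (λ r c′ → M (suc r) (punchIn (suc c) c′)))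
    det-zero-col : ∀ (N : Fin (suc k) → Fin (suc k) → Carrier) → (∀ r → N r zero ≡ 0#) → det (suc k) N ≡ 0#
    det-zero-col N e = trans (det-col₀ k N (λ r → e (suc r))) (trans (cong (_* det k (λ r c → N (suc r) (suc c))) (e zero)) (zeroˡ _))

  det-zero-row : ∀ k (M : Fin (suc k) → Fin (suc k) → Carrier) → (∀ c → M zero c ≡ 0#) → det (suc k) M ≡ 0#
  det-zero-row k M z = trans (det-row₀ k M (λ c → z (suc c))) (trans (cong (_* det k (λ r c → M (suc r) (suc c))) (z zero)) (zeroˡ _))

  det-zero-col : ∀ k (M : Fin (suc k) → Fin (suc k) → Carrier) → (∀ r → M r zero ≡ 0#) → det (suc k) M ≡ 0#
  det-zero-col k M z = trans (det-col₀ k M (λ r → z (suc r))) (trans (cong (_* det k (λ r c → M (suc r) (suc c))) (z zero)) (zeroˡ _))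

  det-triangular-pos : ∀ k (M : Fin k → Fin k → Carrier) → (∀ a b → toℕ a ℕ.< toℕ b → M a b ≡ 0#) →
                       (∀ l → 0# < M l l) → 0# < det k M
  det-triangular-pos zero    M z d = 0<1
  det-triangular-pos (suc k) M z d =
    subst (0# <_) (sym (det-row₀ k M (λ c → z zero (suc c) (s≤s z≤n))))
      (*-pos (d zero) (det-triangular-pos k (λ r c → M (suc r) (suc c)) (λ a b p → z (suc a) (suc b) (s≤s p)) (λ l → d (suc l))))

  -- Riordan arrays as Toeplitz products

  toeplitz-≤ : ∀ (a : Seq) n j → j ℕ.≤ n → toeplitz a n j ≡ a (n ∸ j)
  toeplitz-≤ a n j p with j ℕₚ.≤? n
  ... | yes _ = refl
  ... | no  q = ⊥-elim (q p)

  toeplitz-> : ∀ (a : Seq) n j → n ℕ.< j → toeplitz a n j ≡ 0#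
  toeplitz-> a n j p with j ℕₚ.≤? n
  ... | yes q = ⊥-elim (ℕₚ.<-irrefl refl (ℕₚ.<-≤-trans p q))
  ... | no  _ = refl

  conv≡sumRange : ∀ (a c : Seq) n → conv a c n ≡ sumRange 0 (suc n) (λ i → a i * c (n ∸ i))
  conv≡sumRange a c n = sumTo≡sumRange (suc n) _

  conv≡toeplitz-sum : ∀ (a c : Seq) n m → n ℕ.< m → conv a c n ≡ sumRange 0 m (λ j → toeplitz a n j * c j)
  conv≡toeplitz-sum a c n m n<m = begin
    conv a c n                                               ≡⟨ conv≡sumRange a c n ⟩
    sumRange 0 (suc n) (λ i → a i * c (n ∸ i))               ≡⟨ sumRange-reverse n _ ⟩
    sumRange 0 (suc n) (λ i → a (n ∸ i) * c (n ∸ (n ∸ i)))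
      ≡⟨ sumRange-cong-on 0 (suc n) (λ i _ q → cong₂ _*_ (sym (toeplitz-≤ a n i (ℕₚ.≤-pred q))) (cong c (ℕₚ.m∸[m∸n]≡n (ℕₚ.≤-pred q)))) ⟩
    sumRange 0 (suc n) G                                     ≡⟨ sym (+-identityʳ _) ⟩
    sumRange 0 (suc n) G + 0#
      ≡⟨ cong (sumRange 0 (suc n) G +_) (sym (sumRange-zero (suc n) (m ∸ suc n) G (λ i q _ → trans (cong (_* c i) (toeplitz-> a n i q)) (zeroˡ _)))) ⟩
    sumRange 0 (suc n) G + sumRange (suc n) (m ∸ suc n) G    ≡⟨ sym (sumRange-split 0 (suc n) (m ∸ suc n) G) ⟩
    sumRange 0 (suc n ℕ.+ (m ∸ suc n)) G                     ≡⟨ cong (λ t → sumRange 0 t G) (ℕₚ.m+[n∸m]≡n n<m) ⟩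
    sumRange 0 m G                                           ∎
    where
    G : ℕ → Carrier
    G j = toeplitz a n j * c j

  conv-congʳ : ∀ (a : Seq) {c c′ : Seq} n → (∀ i → c i ≡ c′ i) → conv a c n ≡ conv a c′ n
  conv-congʳ a {c} {c′} n e =
    trans (conv≡sumRange a c n) (trans (sumRange-cong 0 (suc n) (λ i → cong (a i *_) (e (n ∸ i)))) (sym (conv≡sumRange a c′ n)))

  conv-xMulˡ : ∀ (a b : Seq) n → conv (xMul a) b n ≡ xMul (conv a b) n
  conv-xMulˡ a b zero    = trans (+-identityˡ _) (zeroˡ _)
  conv-xMulˡ a b (suc n) = begin
    conv (xMul a) b (suc n)                                               ≡⟨ conv≡sumRange (xMul a) b (suc n) ⟩
    0# * b (suc n) + sumRange 1 (suc n) (λ i → xMul a i * b (suc n ∸ i))  ≡⟨ cong₂ _+_ (zeroˡ _) (sumRange-shift 0 (suc n) _) ⟩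
    0# + sumRange 0 (suc n) (λ i → a i * b (n ∸ i))                       ≡⟨ +-identityˡ _ ⟩
    sumRange 0 (suc n) (λ i → a i * b (n ∸ i))                            ≡⟨ sym (conv≡sumRange a b n) ⟩
    conv a b n                                                            ∎

  minor-conv : ∀ (a : Seq) (C : Matrix) k m (ι κ : Fin k → ℕ) → (∀ l → ι l ℕ.< m) →
               minor (λ n j → conv a (λ i → C i j) n) k ι κ ≡
               sumIncreasing k 0 m (λ J → minor (toeplitz a) k ι J * minor C k J κ)
  minor-conv a C k m ι κ ι<m =
    trans (det-cong k (λ r c → conv≡toeplitz-sum a (λ i → C i (κ c)) (ι r) m (ι<m r)))
          (cauchy-binet k 0 m (λ r j → toeplitz a (ι r) j) (λ j c → C j (κ c)))

  minor-ext : ∀ (M : Matrix) k (κ : Fin k → ℕ) → Extensional (λ ι → minor M k ι κ)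
  minor-ext M k κ ι ι′ e = det-cong k (λ r c → cong (λ t → M t (κ c)) (e r))

  minor-extʳ : ∀ (M : Matrix) k (ι : Fin k → ℕ) → Extensional (minor M k ι)
  minor-extʳ M k ι κ κ′ e = det-cong k (λ r c → cong (M (ι r)) (e c))

  -- A Toeplitz minor whose columns J interlace the rows ι (J l ≤ ι l < J (l + 1)) is
  -- triangular with positive diagonal.
  toeplitz-minor-pos : ∀ (a : Seq) → (∀ n → 0# < a n) → ∀ k (ι J : Fin k → ℕ) → (∀ l → J l ℕ.≤ ι l) →
                       (∀ r c → toℕ r ℕ.< toℕ c → ι r ℕ.< J c) → 0# < minor (toeplitz a) k ι J
  toeplitz-minor-pos a pos k ι J J≤ι ι<J =
    det-triangular-pos k _ (λ r c p → toeplitz-> a (ι r) (J c) (ι<J r c p))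
                           (λ l → subst (0# <_) (sym (toeplitz-≤ a (ι l) (J l) (J≤ι l))) (pos _))

  module _ (a : Seq) (C : Matrix) (a-PF : IsPF a) {k m} {ι κ : Fin k → ℕ}
           (ι-inc : Increasing ι) (ι<m : ∀ l → ι l ℕ.< m)
           (C-nonneg : ∀ J → InRange 0 m J → 0# ≤ minor C k J κ) where

    minor-conv-nonneg : 0# ≤ minor (λ n j → conv a (λ i → C i j) n) k ι κ
    minor-conv-nonneg =
      subst (0# ≤_) (sym (minor-conv a C k m ι κ ι<m))
        (sumIncreasing-nonneg k 0 m _ (λ J J-range → *-nonneg (proj₂ a-PF k ι J ι-inc (proj₁ J-range)) (C-nonneg J J-range)))

    minor-conv-pos : (∀ n → 0# < a n) → (J₀ : Fin k → ℕ) → InRange 0 m J₀ → (∀ l → J₀ l ℕ.≤ ι l) →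
                     (∀ r c → toℕ r ℕ.< toℕ c → ι r ℕ.< J₀ c) → 0# < minor C k J₀ κ →
                     0# < minor (λ n j → conv a (λ i → C i j) n) k ι κ
    minor-conv-pos pos J₀ J₀-range J₀≤ι ι<J₀ C-pos =
      subst (0# <_) (sym (minor-conv a C k m ι κ ι<m))
        (sumIncreasing-pos k 0 m _
          (λ J J′ e → cong₂ _*_ (minor-extʳ (toeplitz a) k ι J J′ e) (minor-ext C k κ J J′ e))
          (λ J J-range → *-nonneg (proj₂ a-PF k ι J ι-inc (proj₁ J-range)) (C-nonneg J J-range))
          J₀ J₀-range (*-pos (toeplitz-minor-pos a pos k ι J₀ J₀≤ι ι<J₀) C-pos))

  bounded : ∀ k (ι : Fin k → ℕ) → Σ ℕ (λ m → ∀ l → ι l ℕ.< m)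
  bounded zero    ι = 0 , (λ ())
  bounded (suc k) ι with bounded k (λ l → ι (suc l))
  ... | m , ι<m = suc (ι zero) ℕ.⊔ m , λ { zero → ℕₚ.m≤m⊔n (suc (ι zero)) m
                                          ; (suc l) → ℕₚ.<-≤-trans (ι<m l) (ℕₚ.m≤n⊔m (suc (ι zero)) m) }

  Increasing-pred : ∀ {k} (κ : Fin k → ℕ) → Increasing κ → (∀ l → 1 ℕ.≤ κ l) → Increasing (λ l → pred (κ l))
  Increasing-pred κ inc κ≥1 i j p = pred-mono (κ≥1 i) (inc i j p)
    where
    pred-mono : ∀ {a b} → 1 ℕ.≤ a → a ℕ.< b → pred a ℕ.< pred b
    pred-mono {suc a} {suc b} _ (s≤s a<b) = a<b

  Increasing-tail-pos : ∀ {k} (J : Fin (suc k) → ℕ) → Increasing J → ∀ l → 1 ℕ.≤ J (suc l)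
  Increasing-tail-pos J inc l = ℕₚ.≤-trans (s≤s z≤n) (Increasing-head J inc l)

  Increasing-pos : ∀ {k} (J : Fin (suc k) → ℕ) → Increasing J → 1 ℕ.≤ J zero → ∀ l → 1 ℕ.≤ J l
  Increasing-pos J inc J₀≥1 zero    = J₀≥1
  Increasing-pos J inc J₀≥1 (suc l) = Increasing-tail-pos J inc l

  zero-or-pos : ∀ n → (n ≡ 0) ⊎ (1 ℕ.≤ n)
  zero-or-pos zero    = inj₁ refl
  zero-or-pos (suc n) = inj₂ (s≤s z≤n)

  one-pos : ∀ j → 1 ℕ.≤ j → one j ≡ 0#
  one-pos (suc j) _ = refl

  module _ (C : Matrix) (unit-column : ∀ j → C j 0 ≡ one j) {k} (J κ : Fin (suc k) → ℕ) (J-inc : Increasing J)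
           (κ₀≡0 : κ zero ≡ 0) where

    minor-unit-column-head : J zero ≡ 0 → minor C (suc k) J κ ≡ minor C k (λ l → J (suc l)) (λ l → κ (suc l))
    minor-unit-column-head J₀≡0 = begin
      minor C (suc k) J κ                                   ≡⟨ det-col₀ k (λ r c → C (J r) (κ c)) (λ r → trans (cong (C (J (suc r))) κ₀≡0)
                                                                (trans (unit-column _) (one-pos _ (Increasing-tail-pos J J-inc r)))) ⟩
      C (J zero) (κ zero) * minor C k (λ l → J (suc l)) (λ l → κ (suc l))
        ≡⟨ cong (_* minor C k (λ l → J (suc l)) (λ l → κ (suc l))) (trans (cong₂ C J₀≡0 κ₀≡0) (unit-column 0)) ⟩
      1# * minor C k (λ l → J (suc l)) (λ l → κ (suc l))    ≡⟨ *-identityˡ _ ⟩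
      minor C k (λ l → J (suc l)) (λ l → κ (suc l))         ∎

    minor-unit-column-zero : 1 ℕ.≤ J zero → minor C (suc k) J κ ≡ 0#
    minor-unit-column-zero J₀≥1 =
      det-zero-col k (λ r c → C (J r) (κ c)) (λ r → trans (cong (C (J r)) κ₀≡0) (trans (unit-column _) (one-pos _ (Increasing-pos J J-inc J₀≥1 r))))

  -- R(f, f) is strictly totally positive

  module _ (f : Seq) (f-PF : IsPF f) (f-pos : ∀ n → 0# < f n) where

    -- Column k of the Riordan array R(f, f) is f · f^k, so R(f, f) = T_f · powers.
    powers : Matrix
    powers j k = pow f k j

    module _ (N : ℕ) (IH : ∀ k (ι κ : Fin k → ℕ) → Increasing ι → Increasing κ → (∀ l → κ l ℕ.< N) →
                           0# < minor (riordan f f) k ι κ) where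

      powers-minor-shifted-pos : ∀ k (J κ : Fin k → ℕ) → Increasing J → Increasing κ → (∀ l → κ l ℕ.< suc N) →
                                 (∀ l → 1 ℕ.≤ κ l) → 0# < minor powers k J κ
      powers-minor-shifted-pos k J κ J-inc κ-inc κ≤N κ≥1 =
        subst (0# <_) (det-cong k (λ r c → shift (J r) (κ c) (κ≥1 c)))
          (IH k J (λ l → pred (κ l)) J-inc (Increasing-pred κ κ-inc κ≥1) (λ l → ℕₚ.∸-monoˡ-< (κ≤N l) (κ≥1 l)))
        where
        shift : ∀ j k′ → 1 ℕ.≤ k′ → riordan f f j (pred k′) ≡ powers j k′
        shift j (suc k′) _ = refl

      powers-minor-pos : ∀ k (J κ : Fin (suc k) → ℕ) → Increasing J → Increasing κ → (∀ l → κ l ℕ.< suc N) →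
                         (κ zero ≡ 0 → J zero ≡ 0) → 0# < minor powers (suc k) J κ
      powers-minor-pos k J κ J-inc κ-inc κ≤N κ₀≡0⇒J₀≡0 with zero-or-pos (κ zero)
      ... | inj₂ κ₀≥1 = powers-minor-shifted-pos (suc k) J κ J-inc κ-inc κ≤N (Increasing-pos κ κ-inc κ₀≥1)
      ... | inj₁ κ₀≡0 =
        subst (0# <_) (sym (minor-unit-column-head powers (λ _ → refl) J κ J-inc κ₀≡0 (κ₀≡0⇒J₀≡0 κ₀≡0)))
          (powers-minor-shifted-pos k _ _ (Increasing-tail J J-inc) (Increasing-tail κ κ-inc) (λ l → κ≤N (suc l))
                                    (Increasing-tail-pos κ κ-inc))

      powers-minor-nonneg : ∀ k (J κ : Fin (suc k) → ℕ) → Increasing J → Increasing κ → (∀ l → κ l ℕ.< suc N) →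
                            0# ≤ minor powers (suc k) J κ
      powers-minor-nonneg k J κ J-inc κ-inc κ≤N with zero-or-pos (κ zero) | zero-or-pos (J zero)
      ... | inj₁ κ₀≡0 | inj₂ J₀≥1 = inj₂ (sym (minor-unit-column-zero powers (λ _ → refl) J κ J-inc κ₀≡0 J₀≥1))
      ... | inj₁ κ₀≡0 | inj₁ J₀≡0 = inj₁ (powers-minor-pos k J κ J-inc κ-inc κ≤N (λ _ → J₀≡0))
      ... | inj₂ κ₀≥1 | _         = inj₁ (powers-minor-shifted-pos (suc k) J κ J-inc κ-inc κ≤N (Increasing-pos κ κ-inc κ₀≥1))

    riordan-ff-minor-pos : ∀ N k (ι κ : Fin k → ℕ) → Increasing ι → Increasing κ → (∀ l → κ l ℕ.< N) →
                           0# < minor (riordan f f) k ι κ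
    riordan-ff-minor-pos N       zero    ι κ _ _ _ = 0<1
    riordan-ff-minor-pos zero    (suc k) ι κ _ _ κ<0 = ⊥-elim (ℕₚ.n≮0 (κ<0 zero))
    riordan-ff-minor-pos (suc N) (suc k) ι κ ι-inc κ-inc κ≤N =
      minor-conv-pos f powers f-PF {κ = κ} ι-inc ι<m
        (λ J J-range → powers-minor-nonneg N (riordan-ff-minor-pos N) k J κ (proj₁ J-range) κ-inc κ≤N)
        f-pos J₀ (J₀-inc , (λ _ → z≤n) , J₀<m) J₀≤ι ι<J₀
        (powers-minor-pos N (riordan-ff-minor-pos N) k J₀ κ J₀-inc κ-inc κ≤N (λ _ → refl))
      where
      m : ℕ
      m = proj₁ (bounded (suc k) ι)
      ι<m : ∀ l → ι l ℕ.< m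
      ι<m = proj₂ (bounded (suc k) ι)
      J₀ : Fin (suc k) → ℕ
      J₀ = 0 ∷ (λ l → ι (suc l))
      J₀-inc : Increasing J₀
      J₀-inc = Increasing-∷ 0 _ (Increasing-tail ι ι-inc) (λ l → ℕₚ.≤-<-trans z≤n (Increasing-head ι ι-inc l))
      J₀<m : ∀ l → J₀ l ℕ.< m
      J₀<m zero    = ℕₚ.≤-<-trans z≤n (ι<m zero)
      J₀<m (suc l) = ι<m (suc l)
      J₀≤ι : ∀ l → J₀ l ℕ.≤ ι l
      J₀≤ι zero    = z≤n
      J₀≤ι (suc l) = ℕₚ.≤-refl
      ι<J₀ : ∀ r c → toℕ r ℕ.< toℕ c → ι r ℕ.< J₀ c
      ι<J₀ r (suc c) r<c = ι-inc r (suc c) r<c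

    riordan-ff-STP : STP (riordan f f)
    riordan-ff-STP k ι κ ι-inc κ-inc = riordan-ff-minor-pos _ k ι κ ι-inc κ-inc (proj₂ (bounded k κ))

  -- R(f, x f) is lower strictly totally positive

  LowerPositive : Matrix → ∀ k → (Fin k → ℕ) → (Fin k → ℕ) → Set
  LowerPositive M k ι κ = (0# ≤ minor M k ι κ) × ((∀ l → κ l ℕ.≤ ι l) → 0# < minor M k ι κ)

  -- The column indices of a positive term in the Cauchy–Binet expansion of a minor
  -- of R(f, x f) with κ ≤ ι.
  interlacing : ∀ {k} → (Fin (suc k) → ℕ) → (Fin (suc k) → ℕ) → Fin (suc k) → ℕ
  interlacing ι κ zero    = κ zero
  interlacing ι κ (suc l) = κ (suc l) ℕ.⊔ suc (ι (Fin.inject₁ l))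

  module _ {k} (ι κ : Fin (suc k) → ℕ) (ι-inc : Increasing ι) where

    ι<interlacing : ∀ r c → toℕ r ℕ.< toℕ c → ι r ℕ.< interlacing ι κ c
    ι<interlacing r (suc l) r<c =
      ℕₚ.<-≤-trans (s≤s (Increasing-mono ι ι-inc r (Fin.inject₁ l) (subst (toℕ r ℕ.≤_) (sym (Finₚ.toℕ-inject₁ l)) (ℕₚ.≤-pred r<c))))
                   (ℕₚ.m≤n⊔m (κ (suc l)) _)

    interlacing≤ι : (∀ l → κ l ℕ.≤ ι l) → ∀ l → interlacing ι κ l ℕ.≤ ι l
    interlacing≤ι κ≤ι zero    = κ≤ι zero
    interlacing≤ι κ≤ι (suc l) = ℕₚ.⊔-lub (κ≤ι (suc l)) (ι-inc (Fin.inject₁ l) (suc l) (s≤s (ℕₚ.≤-reflexive (Finₚ.toℕ-inject₁ l))))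

    κ≤interlacing : ∀ l → κ l ℕ.≤ interlacing ι κ l
    κ≤interlacing zero    = ℕₚ.≤-refl
    κ≤interlacing (suc l) = ℕₚ.m≤m⊔n (κ (suc l)) _

    interlacing-inc : (∀ l → κ l ℕ.≤ ι l) → Increasing (interlacing ι κ)
    interlacing-inc κ≤ι r c r<c = ℕₚ.≤-<-trans (interlacing≤ι κ≤ι r) (ι<interlacing r c r<c)

  module _ (f : Seq) (f-PF : IsPF f) (f-pos : ∀ n → 0# < f n) where

    -- Column k + 1 of R(f, x f) is f · (x · column k), so R(f, x f) = T_f · shifted,
    -- whose minors are (shifted) minors of R(f, x f) itself.
    shifted : Matrix
    shifted j zero    = one j
    shifted j (suc k) = xMul (λ n → riordan f (xMul f) n k) j

    riordan-fxf≡conv : ∀ n k → riordan f (xMul f) n k ≡ conv f (λ j → shifted j k) n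
    riordan-fxf≡conv n zero    = refl
    riordan-fxf≡conv n (suc k) = conv-congʳ f n (λ i → conv-xMulˡ f (pow (xMul f) k) i)

    riordan-fxf-lower : LowerTriangular (riordan f (xMul f))
    riordan-fxf-lower n zero    ()
    riordan-fxf-lower n (suc k) n<k+1 =
      trans (riordan-fxf≡conv n (suc k))
        (trans (conv≡sumRange f (λ j → shifted j (suc k)) n)
          (sumRange-zero 0 (suc n) _ (λ i _ _ → trans (cong (f i *_) (above (n ∸ i) (ℕₚ.m∸n≤m n i))) (zeroʳ _))))
      where
      above : ∀ j → j ℕ.≤ n → shifted j (suc k) ≡ 0#
      above zero    _ = refl
      above (suc j) j<n = riordan-fxf-lower j k (ℕₚ.<-≤-trans j<n (ℕₚ.≤-pred n<k+1))

    RowsBelow : ℕ → Set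
    RowsBelow N = ∀ k (ι κ : Fin k → ℕ) → Increasing ι → Increasing κ → (∀ l → ι l ℕ.< N) →
                  LowerPositive (riordan f (xMul f)) k ι κ

    module _ (N : ℕ) (IH : RowsBelow N) where

      shifted-minor-shifted : ∀ k (J κ : Fin k → ℕ) → Increasing J → Increasing κ → (∀ l → J l ℕ.< suc N) →
                              (∀ l → 1 ℕ.≤ J l) → (∀ l → 1 ℕ.≤ κ l) →
                              LowerPositive shifted k J κ
      shifted-minor-shifted k J κ J-inc κ-inc J≤N J≥1 κ≥1 =
          subst (0# ≤_) shift-minor (proj₁ IH-minor)
        , λ κ≤J → subst (0# <_) shift-minor (proj₂ IH-minor (λ l → ℕₚ.∸-monoˡ-≤ 1 (κ≤J l)))
        where
        shift : ∀ j k′ → 1 ℕ.≤ j → 1 ℕ.≤ k′ → riordan f (xMul f) (pred j) (pred k′) ≡ shifted j k′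
        shift (suc j) (suc k′) _ _ = refl
        shift-minor : minor (riordan f (xMul f)) k (λ l → pred (J l)) (λ l → pred (κ l)) ≡ minor shifted k J κ
        shift-minor = det-cong k (λ r c → shift (J r) (κ c) (J≥1 r) (κ≥1 c))
        IH-minor : LowerPositive (riordan f (xMul f)) k (λ l → pred (J l)) (λ l → pred (κ l))
        IH-minor = IH k (λ l → pred (J l)) (λ l → pred (κ l)) (Increasing-pred J J-inc J≥1) (Increasing-pred κ κ-inc κ≥1)
                      (λ l → ℕₚ.∸-monoˡ-< (J≤N l) (J≥1 l))

      shifted-minor : ∀ k (J κ : Fin (suc k) → ℕ) → Increasing J → Increasing κ → (∀ l → J l ℕ.< suc N) →
                      (0# ≤ minor shifted (suc k) J κ) ×
                      ((∀ l → κ l ℕ.≤ J l) → (κ zero ≡ 0 → J zero ≡ 0) → 0# < minor shifted (suc k) J κ)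
      shifted-minor k J κ J-inc κ-inc J≤N with zero-or-pos (J zero) | zero-or-pos (κ zero)
      ... | inj₁ J₀≡0 | inj₁ κ₀≡0 =
          subst (0# ≤_) (sym head) (proj₁ tail-minor)
        , λ κ≤J _ → subst (0# <_) (sym head) (proj₂ tail-minor (λ l → κ≤J (suc l)))
        where
        head : minor shifted (suc k) J κ ≡ minor shifted k (λ l → J (suc l)) (λ l → κ (suc l))
        head = minor-unit-column-head shifted (λ _ → refl) J κ J-inc κ₀≡0 J₀≡0
        tail-minor : LowerPositive shifted k (λ l → J (suc l)) (λ l → κ (suc l))
        tail-minor = shifted-minor-shifted k _ _ (Increasing-tail J J-inc) (Increasing-tail κ κ-inc) (λ l → J≤N (suc l))
                                           (Increasing-tail-pos J J-inc) (Increasing-tail-pos κ κ-inc)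
      ... | inj₁ J₀≡0 | inj₂ κ₀≥1 =
          inj₂ (sym (det-zero-row k (λ r c → shifted (J r) (κ c)) (λ c → trans (cong (λ j → shifted j (κ c)) J₀≡0)
                                                                        (row₀ (κ c) (Increasing-pos κ κ-inc κ₀≥1 c)))))
        , λ κ≤J _ → ⊥-elim (ℕₚ.<⇒≱ κ₀≥1 (subst (κ zero ℕ.≤_) J₀≡0 (κ≤J zero)))
        where
        row₀ : ∀ k′ → 1 ℕ.≤ k′ → shifted 0 k′ ≡ 0#
        row₀ (suc k′) _ = refl
      ... | inj₂ J₀≥1 | inj₁ κ₀≡0 =
          inj₂ (sym (minor-unit-column-zero shifted (λ _ → refl) J κ J-inc κ₀≡0 J₀≥1))
        , λ _ κ₀≡0⇒J₀≡0 → ⊥-elim (ℕₚ.<⇒≢ J₀≥1 (sym (κ₀≡0⇒J₀≡0 κ₀≡0)))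
      ... | inj₂ J₀≥1 | inj₂ κ₀≥1 =
          proj₁ all-shifted , λ κ≤J _ → proj₂ all-shifted κ≤J
        where
        all-shifted : LowerPositive shifted (suc k) J κ
        all-shifted = shifted-minor-shifted (suc k) J κ J-inc κ-inc J≤N (Increasing-pos J J-inc J₀≥1) (Increasing-pos κ κ-inc κ₀≥1)

    riordan-fxf-rows-below : ∀ N → RowsBelow N
    riordan-fxf-rows-below N       zero    ι κ _ _ _ = inj₁ 0<1 , λ _ → 0<1
    riordan-fxf-rows-below zero    (suc k) ι κ _ _ ι<0 = ⊥-elim (ℕₚ.n≮0 (ι<0 zero))
    riordan-fxf-rows-below (suc N) (suc k) ι κ ι-inc κ-inc ι≤N =
        subst (0# ≤_) (sym as-conv) (minor-conv-nonneg f shifted f-PF {κ = κ} ι-inc ι≤N shifted-nonneg)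
      , λ κ≤ι → subst (0# <_) (sym as-conv)
          (minor-conv-pos f shifted f-PF {κ = κ} ι-inc ι≤N shifted-nonneg f-pos (interlacing ι κ)
            (interlacing-inc ι κ ι-inc κ≤ι , (λ _ → z≤n) , interlacing≤N κ≤ι)
            (interlacing≤ι ι κ ι-inc κ≤ι) (ι<interlacing ι κ ι-inc)
            (proj₂ (shifted-minor N (riordan-fxf-rows-below N) k (interlacing ι κ) κ (interlacing-inc ι κ ι-inc κ≤ι) κ-inc
                                  (interlacing≤N κ≤ι))
                   (κ≤interlacing ι κ ι-inc) (λ κ₀≡0 → κ₀≡0)))
      where
      interlacing≤N : (∀ l → κ l ℕ.≤ ι l) → ∀ l → interlacing ι κ l ℕ.< suc N
      interlacing≤N κ≤ι l = ℕₚ.≤-<-trans (interlacing≤ι ι κ ι-inc κ≤ι l) (ι≤N l)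
      as-conv : minor (riordan f (xMul f)) (suc k) ι κ ≡ minor (λ n j → conv f (λ i → shifted i j) n) (suc k) ι κ
      as-conv = det-cong (suc k) (λ r c → riordan-fxf≡conv (ι r) (κ c))
      shifted-nonneg : ∀ J → InRange 0 (suc N) J → 0# ≤ minor shifted (suc k) J κ
      shifted-nonneg J (J-inc , _ , J≤N) = proj₁ (shifted-minor N (riordan-fxf-rows-below N) k J κ J-inc κ-inc J≤N)

    riordan-fxf-LSTP : LSTP (riordan f (xMul f))
    riordan-fxf-LSTP =
        riordan-fxf-lower
      , (λ k ι κ ι-inc κ-inc → proj₁ (below k ι κ ι-inc κ-inc))
      , (λ k ι κ ι-inc κ-inc → proj₂ (below k ι κ ι-inc κ-inc))
      where
      below : ∀ k (ι κ : Fin k → ℕ) → Increasing ι → Increasing κ → LowerPositive (riordan f (xMul f)) k ι κ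
      below k ι κ ι-inc κ-inc = riordan-fxf-rows-below _ k ι κ ι-inc κ-inc (proj₂ (bounded k ι))

mainTheorem3 : (R : CompleteOrderedField) (f : ℕ → CompleteOrderedField.Carrier R) →
    Theory.IsPF R f →
    (∀ n → CompleteOrderedField._<_ R (CompleteOrderedField.0# R) (f n)) →
    Theory.STP R (Theory.riordan R f f) × Theory.LSTP R (Theory.riordan R f (Theory.xMul R f))
mainTheorem3 R f f-PF f-pos = riordan-ff-STP f f-PF f-pos , riordan-fxf-LSTP f f-PF f-pos
  where open Positivity R
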